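{- Let $\lambda=(m,n)$ be a $2$-partition. Then $\lambda$ is triangular if and only if $n\le\lceil m/2\rceil$.
   Context: A $2$-partition $(m,n)$ consists of integers $m\ge n\ge0$ (bottom row of $m$ cells, upper row of $n$ cells). A partition $\lambda=(\lambda_1\ge\lambda_2\ge\cdots)$ is triangular if there exist positive reals $r,s$ with $\lambda_j=\lfloor r-jr/s\rfloor$ for integers $1\le j\le s$ and $\lambda_j=0$ for $j>s$ (equivalently, $\lambda$ is the largest partition whose cells lie under the line through $(r,0)$ and $(0,s)$).
   Formalization: In the definition of a triangular partition, the parameters r and s range over the positive rationals instead of the positive reals. -}

module Defs where

open import Data.Nat as ℕ using (ℕ; zero; suc)
open import Data.Integer as ℤ using (ℤ; +_)
open import Data.Rational using (ℚ; 0ℚ; _<_; _≤_; _-_; _*_; _÷_; _/_; floor; positive)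
open import Data.Rational.Properties using (pos⇒nonZero)
open import Data.Product using (Σ; _×_)
open import Relation.Binary.PropositionalEquality using (_≡_)

-- A partition is represented by its sequence of parts λ : ℕ → ℕ,
-- where λ j is the j-th part for j ≥ 1 (the value at index 0 is ignored).

ℕ→ℚ : ℕ → ℚ
ℕ→ℚ j = (+ j) / 1

Triangular : (ℕ → ℕ) → Set
Triangular λp =
  Σ ℚ λ r → Σ ℚ λ s → Σ (0ℚ < r) λ _ → Σ (0ℚ < s) λ hs →
    ((j : ℕ) → 1 ℕ.≤ j →
       (ℕ→ℚ j ≤ s →
          + (λp j) ≡ floor (r - ((ℕ→ℚ j * r) ÷ s) {{pos⇒nonZero s {{positive hs}}}}))
     × (s < ℕ→ℚ j → λp j ≡ 0))

twoPartition : ℕ → ℕ → (ℕ → ℕ)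
twoPartition m n 1 = m
twoPartition m n 2 = n
twoPartition m n _ = 0

{-# OPTIONS --safe #-}

-- Write E j = r − j r / s for the abscissa at height j of the line through (r, 0) and
-- (0, s), so that λ j = ⌊E j⌋ for 1 ≤ j ≤ s. Since E is affine, E 1 + E 3 = 2 E 2. If
-- n > 0 then n ≤ E 2 and E 1 < m + 1, while E 3 < 1 (either ⌊E 3⌋ = 0, or 3 > s and
-- E 3 < 0); hence 2n < m + 2, i.e. n ≤ ⌈m/2⌉. Conversely, if 2n ≤ m + 1, take the line
-- with E 1 = m + ½ and E 2 = n: at every height j ≥ 3 below s it has 0 ≤ E j ≤ E 3 =
-- 2n − m − ½ ≤ ½.
module Submission where

open import Defs
open import Data.Nat using (ℕ; _≤_; ⌈_/2⌉)
open import Function.Bundles using (_⇔_; mk⇔; Equivalence)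

open import Data.Nat as ℕ using (zero; suc; z≤n; s≤s)
import Data.Nat.Properties as ℕ
import Data.Nat.Coprimality as Coprime
open import Data.Integer as ℤ using (+_; 0ℤ)
import Data.Integer.Properties as ℤ
import Data.Integer.DivMod as ℤ
open import Data.Rational as ℚ
  using (ℚ; mkℚ; 0ℚ; 1ℚ; ½; _+_; _-_; -_; _*_; _÷_; 1/_; _/_; floor; *≤*; *<*; Positive; positive)
import Data.Rational.Properties as ℚ
open import Data.Rational.Solver using (module +-*-Solver)
open import Data.Empty using (⊥-elim)
open import Data.Product using (_,_; _×_; proj₁; proj₂)
open import Relation.Binary.PropositionalEquality
open import Relation.Nullary using (yes; no; contradiction)

open +-*-Solver using (solve; _:=_; _:+_; _:-_; _:*_; con)

m≤⌈n/2⌉⇔m+m≤1+n : ∀ {m n} → m ≤ ⌈ n /2⌉ ⇔ m ℕ.+ m ≤ suc n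
m≤⌈n/2⌉⇔m+m≤1+n {m} {n} = mk⇔ to from
  where
  to : m ≤ ⌈ n /2⌉ → m ℕ.+ m ≤ suc n
  to m≤⌈n/2⌉ = ℕ.≤-trans (ℕ.+-mono-≤ m≤⌈n/2⌉ (ℕ.≤-trans m≤⌈n/2⌉ (ℕ.⌊n/2⌋≤⌈n/2⌉ (suc n))))
                         (ℕ.≤-reflexive (ℕ.⌊n/2⌋+⌈n/2⌉≡n (suc n)))
  from : m ℕ.+ m ≤ suc n → m ≤ ⌈ n /2⌉
  from m+m≤1+n = subst (_≤ ⌈ n /2⌉) (sym (ℕ.n≡⌊n+n/2⌋ m)) (ℕ.⌊n/2⌋-mono m+m≤1+n)

i/1≡mkℚ : ∀ i → i / 1 ≡ mkℚ i 0 (Coprime.sym (Coprime.1-coprimeTo ℤ.∣ i ∣))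
i/1≡mkℚ i = ℚ.↥p/↧p≡p (mkℚ i 0 _)

/1-mono-≤ : ∀ {i j} → i ℤ.≤ j → i / 1 ℚ.≤ j / 1
/1-mono-≤ {i} {j} i≤j rewrite i/1≡mkℚ i | i/1≡mkℚ j =
  *≤* (subst₂ ℤ._≤_ (sym (ℤ.*-identityʳ i)) (sym (ℤ.*-identityʳ j)) i≤j)

/1-cancel-< : ∀ {i j} → i / 1 ℚ.< j / 1 → i ℤ.< j
/1-cancel-< {i} {j} i<j rewrite i/1≡mkℚ i | i/1≡mkℚ j with i<j
... | *<* i*1<j*1 = subst₂ ℤ._<_ (ℤ.*-identityʳ i) (ℤ.*-identityʳ j) i*1<j*1

/1-homo-+ : ∀ i j → (i ℤ.+ j) / 1 ≡ i / 1 + j / 1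
/1-homo-+ i j rewrite i/1≡mkℚ i | i/1≡mkℚ j =
  ℚ./-cong (sym (cong₂ ℤ._+_ (ℤ.*-identityʳ i) (ℤ.*-identityʳ j))) refl

-- Stated on ℕ→ℚ because checking /1-homo-+ against types written with ℕ→ℚ and numerals
-- makes Agda normalise _/_ through gcd.
ℕ→ℚ-homo-+ : ∀ a b → ℕ→ℚ (a ℕ.+ b) ≡ ℕ→ℚ a + ℕ→ℚ b
ℕ→ℚ-homo-+ a b = /1-homo-+ (+ a) (+ b)

floor-≤ : ∀ p → floor p / 1 ℚ.≤ p
floor-≤ p@(mkℚ x d _) rewrite i/1≡mkℚ (floor p) =
  *≤* (subst (floor p ℤ.* + suc d ℤ.≤_) (sym (ℤ.*-identityʳ x)) (ℤ.[n/d]*d≤n x (+ suc d)))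

<-floor+1 : ∀ p → p ℚ.< ℤ.suc (floor p) / 1
<-floor+1 p@(mkℚ x d _) rewrite i/1≡mkℚ (ℤ.suc (floor p)) =
  *<* (subst₂ ℤ._<_ (sym (ℤ.*-identityʳ x))
                   (cong (λ q → ℤ.suc q ℤ.* + suc d) (sym (ℤ.div-pos-is-/ℕ x (suc d))))
                   (ℤ.n<s[n/ℕd]*d x (suc d)))

floor-unique : ∀ i p → i / 1 ℚ.≤ p → p ℚ.< ℤ.suc i / 1 → floor p ≡ i
floor-unique i p i≤p p<i+1 = ℤ.≤-antisym (≤-of-< (ℚ.≤-<-trans (floor-≤ p) p<i+1))
                                        (≤-of-< (ℚ.≤-<-trans i≤p (<-floor+1 p)))
  where
  ≤-of-< : ∀ {a b} → a / 1 ℚ.< ℤ.suc b / 1 → a ℤ.≤ b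
  ≤-of-< {a} {b} lt =
    subst (a ℤ.≤_) (ℤ.pred-suc b) (ℤ.i<j⇒i≤pred[j] (/1-cancel-< {a} {ℤ.suc b} lt))

0≤ℕ→ℚ : ∀ k → 0ℚ ℚ.≤ ℕ→ℚ k
0≤ℕ→ℚ k = /1-mono-≤ {0ℤ} {+ k} (ℤ.+≤+ z≤n)

½<1 : ½ ℚ.< 1ℚ
½<1 = *<* (ℤ.+<+ (s≤s (s≤s z≤n)))

floor-unique-½ : ∀ k p → ℕ→ℚ k ℚ.≤ p → p ℚ.≤ ℕ→ℚ k + ½ → floor p ≡ + k
floor-unique-½ k p k≤p p≤k+½ = floor-unique (+ k) p k≤p (begin-strict
  p                ≤⟨ p≤k+½ ⟩
  ℕ→ℚ k + ½        <⟨ ℚ.+-monoʳ-< (ℕ→ℚ k) ½<1 ⟩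
  ℕ→ℚ k + ℕ→ℚ 1    ≡⟨ ℚ.+-comm (ℕ→ℚ k) (ℕ→ℚ 1) ⟩
  ℕ→ℚ 1 + ℕ→ℚ k    ≡⟨ sym (ℕ→ℚ-homo-+ 1 k) ⟩
  ℕ→ℚ (suc k)      ∎)
  where open ℚ.≤-Reasoning

p≤p+q : ∀ p {q} → 0ℚ ℚ.≤ q → p ℚ.≤ p + q
p≤p+q p {q} 0≤q = subst (ℚ._≤ p + q) (ℚ.+-identityʳ p) (ℚ.+-monoʳ-≤ p 0≤q)

p≤q⇒0≤q-p : ∀ {p q} → p ℚ.≤ q → 0ℚ ℚ.≤ q - p
p≤q⇒0≤q-p {p} {q} p≤q = subst (ℚ._≤ q - p) (ℚ.+-inverseʳ p) (ℚ.+-monoˡ-≤ (- p) p≤q)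

p<q⇒p-q<0 : ∀ {p q} → p ℚ.< q → p - q ℚ.< 0ℚ
p<q⇒p-q<0 {p} {q} p<q = subst (p - q ℚ.<_) (ℚ.+-inverseʳ q) (ℚ.+-monoˡ-< (- q) p<q)

line : (r s : ℚ) .{{_ : Positive s}} → ℕ → ℚ
line r s j = r - ((ℕ→ℚ j * r) ÷ s) {{ℚ.pos⇒nonZero s}}

module Line (r s : ℚ) .{{_ : Positive s}} where

  private instance
    s≢0 : ℚ.NonZero s
    s≢0 = ℚ.pos⇒nonZero s

  line-slope : ∀ {d} → s * d ≡ r → ∀ j → line r s j ≡ r - ℕ→ℚ j * d
  line-slope {d} sd≡r j = cong (λ x → r - x) (begin
    ℕ→ℚ j * r * 1/ s        ≡⟨ cong (λ x → ℕ→ℚ j * x * 1/ s) (sym sd≡r) ⟩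
    ℕ→ℚ j * (s * d) * 1/ s  ≡⟨ solve 4 (λ j s d u → j :* (s :* d) :* u := j :* d :* (s :* u))
                                        refl (ℕ→ℚ j) s d (1/ s) ⟩
    ℕ→ℚ j * d * (s * 1/ s)  ≡⟨ cong (ℕ→ℚ j * d *_) (ℚ.*-inverseʳ s) ⟩
    ℕ→ℚ j * d * 1ℚ          ≡⟨ ℚ.*-identityʳ _ ⟩
    ℕ→ℚ j * d               ∎)
    where open ≡-Reasoning

  s*[r÷s]≡r : s * (r ÷ s) ≡ r
  s*[r÷s]≡r = begin
    s * (r * 1/ s)  ≡⟨ solve 3 (λ s r u → s :* (r :* u) := r :* (s :* u)) refl s r (1/ s) ⟩
    r * (s * 1/ s)  ≡⟨ cong (r *_) (ℚ.*-inverseʳ s) ⟩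
    r * 1ℚ          ≡⟨ ℚ.*-identityʳ r ⟩
    r               ∎
    where open ≡-Reasoning

  private
    r÷s≥0 : 0ℚ ℚ.≤ r → ℚ.NonNegative (r ÷ s)
    r÷s≥0 0≤r = ℚ.nonNeg*nonNeg⇒nonNeg r {{ℚ.nonNegative 0≤r}} (1/ s)
                  {{ℚ.pos⇒nonNeg (1/ s) {{ℚ.1/pos⇒pos s}}}}

    r÷s>0 : 0ℚ ℚ.< r → Positive (r ÷ s)
    r÷s>0 0<r = ℚ.pos*pos⇒pos r {{positive 0<r}} (1/ s) {{ℚ.1/pos⇒pos s}}

  line-nonneg : 0ℚ ℚ.≤ r → ∀ {j} → ℕ→ℚ j ℚ.≤ s → 0ℚ ℚ.≤ line r s j
  line-nonneg 0≤r {j} j≤s = subst (0ℚ ℚ.≤_) (sym (line-slope s*[r÷s]≡r j))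
    (p≤q⇒0≤q-p (subst (ℕ→ℚ j * (r ÷ s) ℚ.≤_) s*[r÷s]≡r
                      (ℚ.*-monoʳ-≤-nonNeg (r ÷ s) {{r÷s≥0 0≤r}} j≤s)))

  line-neg : 0ℚ ℚ.< r → ∀ {j} → s ℚ.< ℕ→ℚ j → line r s j ℚ.< 0ℚ
  line-neg 0<r {j} s<j = subst (ℚ._< 0ℚ) (sym (line-slope s*[r÷s]≡r j))
    (p<q⇒p-q<0 (subst (ℚ._< ℕ→ℚ j * (r ÷ s)) s*[r÷s]≡r
                      (ℚ.*-monoˡ-<-pos (r ÷ s) {{r÷s>0 0<r}} s<j)))

  line-nonneg⇒≤ : 0ℚ ℚ.< r → ∀ {j} → 0ℚ ℚ.≤ line r s j → ℕ→ℚ j ℚ.≤ s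
  line-nonneg⇒≤ 0<r {j} 0≤line =
    ℚ.≮⇒≥ (λ s<j → ℚ.<-irrefl refl (ℚ.≤-<-trans 0≤line (line-neg 0<r {j} s<j)))

  line-antitone : 0ℚ ℚ.≤ r → ∀ {i j} → i ≤ j → line r s j ℚ.≤ line r s i
  line-antitone 0≤r {i} {j} i≤j =
    subst₂ ℚ._≤_ (sym (line-slope s*[r÷s]≡r j)) (sym (line-slope s*[r÷s]≡r i))
      (ℚ.+-monoʳ-≤ r (ℚ.neg-antimono-≤
        (ℚ.*-monoʳ-≤-nonNeg (r ÷ s) {{r÷s≥0 0≤r}} (/1-mono-≤ {+ i} {+ j} (ℤ.+≤+ i≤j)))))

  line-midpoint : line r s 1 + line r s 3 ≡ line r s 2 + line r s 2
  line-midpoint = solve 2 (λ r u → (r :- con (ℕ→ℚ 1) :* r :* u) :+ (r :- con (ℕ→ℚ 3) :* r :* u)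
                                 := (r :- con (ℕ→ℚ 2) :* r :* u) :+ (r :- con (ℕ→ℚ 2) :* r :* u))
                          refl r (1/ s)

TriangularWith : (r s : ℚ) .{{_ : Positive s}} → (ℕ → ℕ) → Set
TriangularWith r s λp = ∀ j → 1 ≤ j →
  (ℕ→ℚ j ℚ.≤ s → + λp j ≡ floor (line r s j)) × (s ℚ.< ℕ→ℚ j → λp j ≡ 0)

module _ {λp : ℕ → ℕ} (r s : ℚ) .{{_ : Positive s}} (tri : TriangularWith r s λp) where

  open Line r s

  line<1+part : 0ℚ ℚ.< r → ∀ {j} → 1 ≤ j → line r s j ℚ.< ℕ→ℚ (suc (λp j))
  line<1+part 0<r {j} 1≤j with ℕ→ℚ j ℚ.≤? s
  ... | yes j≤s =
    subst (λ i → line r s j ℚ.< ℤ.suc i / 1) (sym (proj₁ (tri j 1≤j) j≤s)) (<-floor+1 _)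
  ... | no j≰s  = ℚ.<-≤-trans (line-neg 0<r {j} (ℚ.≰⇒> j≰s)) (0≤ℕ→ℚ (suc (λp j)))

  part≤line : ∀ {j} → 1 ≤ j → λp j ≢ 0 → ℕ→ℚ (λp j) ℚ.≤ line r s j
  part≤line {j} 1≤j λpj≢0 with ℕ→ℚ j ℚ.≤? s
  ... | yes j≤s = subst (λ i → i / 1 ℚ.≤ line r s j) (sym (proj₁ (tri j 1≤j) j≤s)) (floor-≤ _)
  ... | no j≰s  = contradiction (proj₂ (tri j 1≤j) (ℚ.≰⇒> j≰s)) λpj≢0

triangular⇒≤⌈/2⌉ : ∀ {m n} → Triangular (twoPartition m n) → n ≤ ⌈ m /2⌉
triangular⇒≤⌈/2⌉ {n = zero} _ = z≤n
triangular⇒≤⌈/2⌉ {m} {n@(suc _)} (r , s , 0<r , 0<s , tri) =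
  Equivalence.from m≤⌈n/2⌉⇔m+m≤1+n (ℕ.≤-pred (ℤ.drop‿+<+ (/1-cancel-< 2n<m+2)))
  where
  instance
    s>0 : Positive s
    s>0 = positive 0<s

  open Line r s

  n≤line₂ : ℕ→ℚ n ℚ.≤ line r s 2
  n≤line₂ = part≤line r s tri {2} (s≤s z≤n) (λ ())

  2n<m+2 : ℕ→ℚ (n ℕ.+ n) ℚ.< ℕ→ℚ (2 ℕ.+ m)
  2n<m+2 = begin-strict
    ℕ→ℚ (n ℕ.+ n)            ≡⟨ ℕ→ℚ-homo-+ n n ⟩
    ℕ→ℚ n + ℕ→ℚ n            ≤⟨ ℚ.+-mono-≤ n≤line₂ n≤line₂ ⟩
    line r s 2 + line r s 2  ≡⟨ sym line-midpoint ⟩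
    line r s 1 + line r s 3  ≡⟨ ℚ.+-comm (line r s 1) (line r s 3) ⟩
    line r s 3 + line r s 1  <⟨ ℚ.+-mono-< (line<1+part r s tri 0<r {3} (s≤s z≤n))
                                            (line<1+part r s tri 0<r {1} (s≤s z≤n)) ⟩
    ℕ→ℚ 1 + ℕ→ℚ (suc m)      ≡⟨ sym (ℕ→ℚ-homo-+ 1 (suc m)) ⟩
    ℕ→ℚ (2 ℕ.+ m)            ∎
    where open ℚ.≤-Reasoning

module TwoRowLine {m n : ℕ} (n≤m : n ≤ m) where

  private
    M N : ℚ
    M = ℕ→ℚ m
    N = ℕ→ℚ n

  slope width : ℚ
  slope = M - N + ½
  width = M + ½ + slope

  instance
    slope>0 : Positive slope
    slope>0 = ℚ.nonNeg+pos⇒pos (M - N)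
                {{ℚ.nonNegative (p≤q⇒0≤q-p (/1-mono-≤ (ℤ.+≤+ n≤m)))}} ½

    width>0 : Positive width
    width>0 = ℚ.pos+pos⇒pos (M + ½) {{ℚ.nonNeg+pos⇒pos M {{ℚ.nonNegative (0≤ℕ→ℚ m)}} ½}} slope

    slope≢0 : ℚ.NonZero slope
    slope≢0 = ℚ.pos⇒nonZero slope

  height : ℚ
  height = width ÷ slope

  instance
    height>0 : Positive height
    height>0 = ℚ.pos*pos⇒pos width (1/ slope) {{ℚ.1/pos⇒pos slope}}

  open Line width height

  height*slope≡width : height * slope ≡ width
  height*slope≡width = begin
    width * 1/ slope * slope    ≡⟨ ℚ.*-assoc width (1/ slope) slope ⟩
    width * (1/ slope * slope)  ≡⟨ cong (width *_) (ℚ.*-inverseˡ slope) ⟩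
    width * 1ℚ                  ≡⟨ ℚ.*-identityʳ width ⟩
    width                       ∎
    where open ≡-Reasoning

  line₁ : line width height 1 ≡ M + ½
  line₁ = trans (line-slope height*slope≡width 1)
    (solve 2 (λ M N → M :+ con ½ :+ (M :- N :+ con ½) :- con (ℕ→ℚ 1) :* (M :- N :+ con ½)
                      := M :+ con ½) refl M N)

  line₂ : line width height 2 ≡ N
  line₂ = trans (line-slope height*slope≡width 2)
    (solve 2 (λ M N → M :+ con ½ :+ (M :- N :+ con ½) :- con (ℕ→ℚ 2) :* (M :- N :+ con ½)
                      := N) refl M N)

  line₃ : line width height 3 ≡ N + N - (M + ½)
  line₃ = trans (line-slope height*slope≡width 3)
    (solve 2 (λ M N → M :+ con ½ :+ (M :- N :+ con ½) :- con (ℕ→ℚ 3) :* (M :- N :+ con ½)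
                      := N :+ N :- (M :+ con ½)) refl M N)

  private
    0≤width : 0ℚ ℚ.≤ width
    0≤width = ℚ.<⇒≤ (ℚ.positive⁻¹ width)

    0≤½ : 0ℚ ℚ.≤ ½
    0≤½ = ℚ.<⇒≤ (ℚ.positive⁻¹ ½)

    M≤line₁ : M ℚ.≤ line width height 1
    M≤line₁ = subst (M ℚ.≤_) (sym line₁) (p≤p+q M 0≤½)

    not-above : ∀ {A : Set} j → 0ℚ ℚ.≤ line width height j → height ℚ.< ℕ→ℚ j → A
    not-above j 0≤line height<j = ⊥-elim (ℚ.<-irrefl refl
      (ℚ.<-≤-trans height<j (line-nonneg⇒≤ (ℚ.positive⁻¹ width) {j} 0≤line)))

  triangularWith : n ℕ.+ n ≤ suc m → TriangularWith width height (twoPartition m n)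
  triangularWith _ 1 _ =
      (λ _ → sym (floor-unique-½ m _ M≤line₁ (ℚ.≤-reflexive line₁)))
    , not-above 1 (ℚ.≤-trans (0≤ℕ→ℚ m) M≤line₁)
  triangularWith _ 2 _ =
      (λ _ → sym (floor-unique-½ n _ (ℚ.≤-reflexive (sym line₂))
                                     (subst (ℚ._≤ N + ½) (sym line₂) (p≤p+q N 0≤½))))
    , not-above 2 (subst (0ℚ ℚ.≤_) (sym line₂) (0≤ℕ→ℚ n))
  triangularWith 2n≤m+1 j@(suc (suc (suc _))) _ =
      (λ j≤height → sym (floor-unique-½ 0 _ (line-nonneg 0≤width {j} j≤height) line≤½))
    , (λ _ → refl)
    where
    line≤½ : line width height j ℚ.≤ ½
    line≤½ = begin
      line width height j      ≤⟨ line-antitone 0≤width {3} {j} (s≤s (s≤s (s≤s z≤n))) ⟩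
      line width height 3      ≡⟨ line₃ ⟩
      N + N - (M + ½)          ≡⟨ cong (_- (M + ½)) (sym (ℕ→ℚ-homo-+ n n)) ⟩
      ℕ→ℚ (n ℕ.+ n) - (M + ½)  ≤⟨ ℚ.+-monoˡ-≤ (- (M + ½))
                                    (/1-mono-≤ {+ (n ℕ.+ n)} {+ suc m} (ℤ.+≤+ 2n≤m+1)) ⟩
      ℕ→ℚ (suc m) - (M + ½)    ≡⟨ cong (_- (M + ½)) (ℕ→ℚ-homo-+ 1 m) ⟩
      ℕ→ℚ 1 + M - (M + ½)      ≡⟨ solve 1 (λ M → con (ℕ→ℚ 1) :+ M :- (M :+ con ½) := con ½) refl M ⟩
      ½                        ∎
      where open ℚ.≤-Reasoning

≤⌈/2⌉⇒triangular : ∀ {m n} → n ≤ m → n ≤ ⌈ m /2⌉ → Triangular (twoPartition m n)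
≤⌈/2⌉⇒triangular n≤m n≤⌈m/2⌉ =
  width , height , ℚ.positive⁻¹ width , ℚ.positive⁻¹ height ,
  triangularWith (Equivalence.to m≤⌈n/2⌉⇔m+m≤1+n n≤⌈m/2⌉)
  where open TwoRowLine n≤m

proposition4p1 : (m n : ℕ) → n ≤ m →
    (Triangular (twoPartition m n) ⇔ n ≤ ⌈ m /2⌉)
proposition4p1 m n n≤m = mk⇔ triangular⇒≤⌈/2⌉ (≤⌈/2⌉⇒triangular n≤m)
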